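{- Let $G=(V,E)$ be a finite simple graph of order $n$ and $T$ a positive integer. For each zero forcing set $C$ corresponding to a zero forcing game in $\mathcal{Z}(G,T)$, there is a feasible solution $(x,y,z)$ of the Time Step Model $\mathrm{TSM}(G,T)$ such that $|C|=\sum_{v\in V}x^0_v$ and $\sum_{t\in[T]}z^t=\operatorname{pt}(G,C)\le T$. Here feasibility means $x^t_v\in\{0,1\}$ ($v\in V$, $t\in\{0,\ldots,T\}$), $y^t_a\in\{0,1\}$ ($a\in A$, $t\in[T]$), $z^t\in\{0,1\}$ ($t\in[T]$) and (1) $x^0_v+\sum_{t\in[T]}\sum_{a=(u,v)\in A}y^t_a=1$ for all $v$; (2) $y^t_a\le x^{t-1}_u$ for all $a=(u,v)\in A$, $t\in[T]$; (3) $y^t_a\le x^{t-1}_w$ for all $a=(u,v)\in A$, $w\in N(u)\setminus\{v\}$, $t\in[T]$; (4) $x^t_v=x^{t-1}_v+\sum_{a=(u,v)\in A}y^t_a$ for all $v$, $t\in[T]$; (5) $x^{t-1}_u-x^{t-1}_v+\sum_{w\in N(u)\setminus\{v\}}x^{t-1}_w\le\sum_{a=(w,v)\in A}y^t_a+\deg(u)-1$ for all $(u,v)\in A$, $t\in[T]$; (6) $\frac1n\sum_{v}(x^t_v-x^{t-1}_v)-z^t\le0$ for all $t\in[T]$; (7) $z^t-\sum_{v}(x^t_v-x^{t-1}_v)\le0$ for all $t\in[T]$.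
   Context: $[T]=\{1,\ldots,T\}$; $N(u)$ is the neighborhood, $\deg(u)=|N(u)|$; $A$ contains both arcs $(u,v),(v,u)$ for each edge. Standard zero forcing rule: a filled vertex $u$ forces a non-filled vertex $v$ if $v$ is the only non-filled neighbor of $u$. A zero forcing game with initial set $C$ consists of sets $C^{(t)}$, $C^{[t]}$ with $C=C^{(0)}=C^{[0]}$, $C^{[t]}=C^{[t-1]}\cup C^{(t)}$, every vertex in exactly one $C^{(t)}$, each $v\in C^{(t)}$ ($t\ge1$) forced by exactly one neighbor $u$ with $u$ and all neighbors of $u$ except $v$ in $C^{[t-1]}$. $\mathcal{Z}(G,T)$ is the family of zero forcing games whose initial set is a zero forcing set, which use at most $T$ time steps, and in which at each time step all possible forces that can be done independently are applied. $\operatorname{pt}(G,C)$ is the number of time steps needed to fill all vertices from $C$ when all possible forces are applied at each step. -}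

module Defs where

open import Data.Nat as ℕ using (ℕ; zero; suc; _<_; _≤_)
open import Data.Integer as ℤ using (ℤ; +_; 0ℤ; 1ℤ; _+_; _-_; _*_)
open import Data.Bool using (Bool; true; false; if_then_else_; _∧_; not)
open import Data.Fin using (Fin; zero; suc; _≟_)
open import Data.Fin.Subset using (Subset; _∈_)
open import Data.Product using (Σ; ∃; _×_; _,_)
open import Data.Sum using (_⊎_)
open import Relation.Nullary using (¬_; does)
open import Relation.Binary.PropositionalEquality using (_≡_; _≢_)

record Graph (n : ℕ) : Set where
  field
    adj   : Fin n → Fin n → Bool
    sym   : ∀ u v → adj u v ≡ adj v u
    irref : ∀ u → adj u u ≡ false

open Graph public

sumV : ∀ {n} → (Fin n → ℤ) → ℤ
sumV {zero}  f = 0ℤ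
sumV {suc n} f = f zero + sumV (λ i → f (suc i))

sumT : ℕ → (ℕ → ℤ) → ℤ
sumT zero    f = 0ℤ
sumT (suc T) f = sumT T f + f (suc T)

deg : ∀ {n} → Graph n → Fin n → ℤ
deg G u = sumV (λ w → if adj G u w then 1ℤ else 0ℤ)

sumNbrExcept : ∀ {n} → Graph n → Fin n → Fin n → (Fin n → ℤ) → ℤ
sumNbrExcept G u v f =
  sumV (λ w → if adj G u w ∧ not (does (w ≟ v)) then f w else 0ℤ)

-- Σ_{a=(u,v) ∈ A} y_a  (arcs entering v); y is indexed by tail and head
sumIn : ∀ {n} → Graph n → (Fin n → Fin n → ℤ) → Fin n → ℤ
sumIn G y v = sumV (λ u → if adj G u v then y u v else 0ℤ)

-- Filled G C t v : v ∈ C^[t] when all possible forces are applied at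
-- each time step, starting from C.
data Filled {n} (G : Graph n) (C : Subset n) : ℕ → Fin n → Set where
  base  : ∀ {v} → v ∈ C → Filled G C zero v
  keep  : ∀ {t v} → Filled G C t v → Filled G C (suc t) v
  force : ∀ {t v} (u : Fin n) → Filled G C t u → adj G u v ≡ true →
          (∀ w → adj G u w ≡ true → w ≢ v → Filled G C t w) →
          Filled G C (suc t) v

ZeroForcingSet : ∀ {n} → Graph n → Subset n → Set
ZeroForcingSet G C = ∃ λ t → ∀ v → Filled G C t v

IsPT : ∀ {n} → Graph n → Subset n → ℕ → Set
IsPT G C k = (∀ v → Filled G C k v) ×
             (∀ j → j < k → ¬ (∀ v → Filled G C j v))

-- Zero forcing games in 𝒵(G,T) with initial set C.
-- time v = the unique t with v ∈ C^(t); forcer v = the neighbour forcing v.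

record ZGame {n} (G : Graph n) (T : ℕ) (C : Subset n) : Set where
  field
    zfs     : ZeroForcingSet G C
    time    : Fin n → ℕ
    forcer  : Fin n → Fin n
    initial : ∀ v → (time v ≡ 0 → v ∈ C) × (v ∈ C → time v ≡ 0)
    bounded : ∀ v → time v ≤ T
    valid   : ∀ v → 1 ≤ time v →
              (adj G (forcer v) v ≡ true) ×
              (time (forcer v) < time v) ×
              (∀ w → adj G (forcer v) w ≡ true → w ≢ v → time w < time v)
    -- all possible forces are applied at each time step t ≥ 1:
    -- a vertex not in C^[t-1] that can be forced from C^[t-1] lies in C^(t)
    maximal : ∀ t u v → t ≤ time v → time u < t → adj G u v ≡ true →
              (∀ w → adj G u w ≡ true → w ≢ v → time w < t) →
              time v ≡ t

-- Time Step Model TSM(G,T)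
-- x t v  (t ∈ {0..T}),  y t u v  (arc (u,v), t ∈ [T]),  z t  (t ∈ [T]).
-- Constraints with t ∈ [T] are written with t = suc s, s < T.

Binary : ℤ → Set
Binary b = b ≡ 0ℤ ⊎ b ≡ 1ℤ

record Feasible {n} (G : Graph n) (T : ℕ)
                (x : ℕ → Fin n → ℤ) (y : ℕ → Fin n → Fin n → ℤ) (z : ℕ → ℤ) : Set where
  field
    x-bin : ∀ t → t ≤ T → ∀ v → Binary (x t v)
    y-bin : ∀ t → 1 ≤ t → t ≤ T → ∀ u v → adj G u v ≡ true → Binary (y t u v)
    z-bin : ∀ t → 1 ≤ t → t ≤ T → Binary (z t)
    c1 : ∀ v → x 0 v + sumT T (λ t → sumIn G (y t) v) ≡ 1ℤ
    c2 : ∀ s → s < T → ∀ u v → adj G u v ≡ true →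
         y (suc s) u v ℤ.≤ x s u
    c3 : ∀ s → s < T → ∀ u v w → adj G u v ≡ true → adj G u w ≡ true → w ≢ v →
         y (suc s) u v ℤ.≤ x s w
    c4 : ∀ s → s < T → ∀ v → x (suc s) v ≡ x s v + sumIn G (y (suc s)) v
    c5 : ∀ s → s < T → ∀ u v → adj G u v ≡ true →
         x s u - x s v + sumNbrExcept G u v (x s)
           ℤ.≤ sumIn G (y (suc s)) v + deg G u - 1ℤ
    -- (6) multiplied through by n:  Σ_v (x^t_v - x^{t-1}_v) ≤ n · z^t
    c6 : ∀ s → s < T →
         sumV (λ v → x (suc s) v - x s v) ℤ.≤ + n * z (suc s)
    c7 : ∀ s → s < T →
         z (suc s) - sumV (λ v → x (suc s) v - x s v) ℤ.≤ 0ℤ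

{-# OPTIONS --safe #-}
-- Read the TSM variables off the game: x^t_v = [v is filled by time t],
-- y^t_(u,v) = [u forces v at time t] and z^t = [t ≤ pt(G,C)].  Since all
-- possible forces are applied at every step, a vertex is filled after t
-- parallel steps iff its game time is at most t, so pt(G,C) is the largest game
-- time.  Constraints (1)–(4) are bookkeeping of the forces, (5) expresses the
-- maximality of the game, and (6) and (7) hold because the game times fill an
-- initial segment of ℕ: a step at which nothing is forced leaves nothing to
-- force later.
module Submission where

open import Defs
open import Data.Nat using (ℕ; _≤_)
open import Data.Integer using (ℤ; +_)
open import Data.Fin using (Fin)
open import Data.Fin.Subset using (Subset; ∣_∣)
open import Data.Product using (Σ; ∃; _×_)
open import Relation.Binary.PropositionalEquality using (_≡_)

open import Level using (Level)
open import Function using (_∘_)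
open import Data.Bool using (Bool; true; false; if_then_else_; _∧_; not)
import Data.Bool as Bool
open import Data.Nat using (zero; suc; _<_; _⊓_; _⊔_; z≤n; s≤s; _≤?_)
import Data.Nat as ℕ
open import Data.Nat.Properties
  using (≤-refl; ≤-trans; ≤-reflexive; ≤-antisym; ≤-pred; <⇒≤; <⇒≱; ≰⇒>; m≤n⇒m≤1+n; n≤0⇒n≡0;
         m≤m⊔n; m≤n⊔m; ⊔-lub; m≤n⇒m⊓n≡m; m≥n⇒m⊓n≡n)
import Data.Nat.Properties as ℕ
open import Data.Nat.Induction using (<-wellFounded)
open import Induction.WellFounded using (Acc; acc)
open import Data.Integer using (0ℤ; 1ℤ; _+_; _-_; _*_)
import Data.Integer as ℤ
import Data.Integer.Properties as ℤ
open import Data.Integer.Tactic.RingSolver using (solve-∀)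
open import Algebra.Properties.CommutativeSemigroup ℤ.+-commutativeSemigroup using (interchange)
open import Data.Fin using (zero; suc; _≟_)
open import Data.Fin.Properties using (suc-injective; any?)
open import Data.Fin.Subset using (inside; outside; _∈_)
open import Data.Fin.Subset.Properties using (_∈?_)
open import Data.Vec using (_∷_; [])
open import Data.Product using (_,_; proj₁; proj₂)
open import Data.Sum using (inj₁; inj₂)
open import Relation.Nullary using (¬_; Dec; yes; no; does; contradiction)
open import Relation.Nullary.Decidable using (_×-dec_; ¬?; dec-true; dec-false; decidable-stable)
open import Relation.Binary.PropositionalEquality
  using (refl; trans; cong; cong₂; subst; _≢_; module ≡-Reasoning)
import Relation.Binary.PropositionalEquality as ≡

private
  variable
    p q : Level
    P : Set p
    Q : Set q
    n : ℕ

-- Opaque so that unification recovers the decision d from 𝟙 d.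
opaque
  𝟙 : Dec P → ℤ
  𝟙 d = if does d then 1ℤ else 0ℤ

  𝟙-binary : (d : Dec P) → Binary (𝟙 d)
  𝟙-binary (yes _) = inj₂ refl
  𝟙-binary (no _)  = inj₁ refl

  𝟙-true : (d : Dec P) → P → 𝟙 d ≡ 1ℤ
  𝟙-true d p rewrite dec-true d p = refl

  𝟙-false : (d : Dec P) → ¬ P → 𝟙 d ≡ 0ℤ
  𝟙-false d ¬p rewrite dec-false d ¬p = refl

  0≤𝟙 : (d : Dec P) → 0ℤ ℤ.≤ 𝟙 d
  0≤𝟙 (yes _) = ℤ.+≤+ z≤n
  0≤𝟙 (no _)  = ℤ.+≤+ z≤n

  𝟙≤1 : (d : Dec P) → 𝟙 d ℤ.≤ 1ℤ
  𝟙≤1 (yes _) = ℤ.+≤+ (s≤s z≤n)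
  𝟙≤1 (no _)  = ℤ.+≤+ z≤n

  𝟙-mono : (P → Q) → (d : Dec P) (d′ : Dec Q) → 𝟙 d ℤ.≤ 𝟙 d′
  𝟙-mono P⇒Q (yes p) d′    = ℤ.≤-reflexive (≡.sym (𝟙-true d′ (P⇒Q p)))
  𝟙-mono P⇒Q (no _)  d′    = 0≤𝟙 d′

𝟙-cong : (P → Q) → (Q → P) → (d : Dec P) (d′ : Dec Q) → 𝟙 d ≡ 𝟙 d′
𝟙-cong P⇒Q Q⇒P d d′ = ℤ.≤-antisym (𝟙-mono P⇒Q d d′) (𝟙-mono Q⇒P d′ d)

if-mono : ∀ (b : Bool) {i j} → i ℤ.≤ j → (if b then i else 0ℤ) ℤ.≤ (if b then j else 0ℤ)
if-mono true  i≤j = i≤j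
if-mono false _   = ℤ.≤-refl

if-zero : ∀ (b : Bool) {i} → i ≡ 0ℤ → (if b then i else 0ℤ) ≡ 0ℤ
if-zero true  i≡0 = i≡0
if-zero false _   = refl

sumV-cong : {f g : Fin n → ℤ} → (∀ v → f v ≡ g v) → sumV f ≡ sumV g
sumV-cong {zero}  _   = refl
sumV-cong {suc n} f≡g = cong₂ _+_ (f≡g zero) (sumV-cong (f≡g ∘ suc))

sumV-mono : {f g : Fin n → ℤ} → (∀ v → f v ℤ.≤ g v) → sumV f ℤ.≤ sumV g
sumV-mono {zero}  _   = ℤ.≤-refl
sumV-mono {suc n} f≤g = ℤ.+-mono-≤ (f≤g zero) (sumV-mono (f≤g ∘ suc))

sumV-mono-< : {f g : Fin n → ℤ} → (∀ v → f v ℤ.≤ g v) → ∀ w → f w ℤ.< g w → sumV f ℤ.< sumV g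
sumV-mono-< f≤g zero    fw<gw = ℤ.+-mono-<-≤ fw<gw (sumV-mono (f≤g ∘ suc))
sumV-mono-< f≤g (suc w) fw<gw = ℤ.+-mono-≤-< (f≤g zero) (sumV-mono-< (f≤g ∘ suc) w fw<gw)

sumV-+ : (f g : Fin n → ℤ) → sumV (λ v → f v + g v) ≡ sumV f + sumV g
sumV-+ {zero}  f g = refl
sumV-+ {suc n} f g = begin
  f zero + g zero + sumV (λ v → f (suc v) + g (suc v))
    ≡⟨ cong (_+_ (f zero + g zero)) (sumV-+ (f ∘ suc) (g ∘ suc)) ⟩
  f zero + g zero + (sumV (f ∘ suc) + sumV (g ∘ suc))
    ≡⟨ interchange (f zero) (g zero) (sumV (f ∘ suc)) (sumV (g ∘ suc)) ⟩
  f zero + sumV (f ∘ suc) + (g zero + sumV (g ∘ suc)) ∎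
  where open ≡-Reasoning

sumV-const : ∀ n c → sumV {n} (λ _ → c) ≡ + n * c
sumV-const zero    c = refl
sumV-const (suc n) c = begin
  c + sumV {n} (λ _ → c)  ≡⟨ cong (_+_ c) (sumV-const n c) ⟩
  c + + n * c             ≡⟨ cong (_+ + n * c) (ℤ.*-identityˡ c) ⟨
  1ℤ * c + + n * c        ≡⟨ ℤ.*-distribʳ-+ c 1ℤ (+ n) ⟨
  (1ℤ + + n) * c          ∎
  where open ≡-Reasoning

sumV-zero : {f : Fin n → ℤ} → (∀ v → f v ≡ 0ℤ) → sumV f ≡ 0ℤ
sumV-zero {n} f≡0 = trans (sumV-cong f≡0) (trans (sumV-const n 0ℤ) (ℤ.*-zeroʳ (+ n)))

sumV-delta : (f : Fin n → ℤ) (w : Fin n) → (∀ v → v ≢ w → f v ≡ 0ℤ) → sumV f ≡ f w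
sumV-delta f zero f≡0 =
  trans (cong (_+_ (f zero)) (sumV-zero (λ v → f≡0 (suc v) λ ()))) (ℤ.+-identityʳ (f zero))
sumV-delta f (suc w) f≡0 =
  trans (cong₂ _+_ (f≡0 zero λ ()) (sumV-delta (f ∘ suc) w (λ v v≢w → f≡0 (suc v) (v≢w ∘ suc-injective))))
        (ℤ.+-identityˡ (f (suc w)))

opaque
  unfolding 𝟙

  sumV-∈ : (C : Subset n) → sumV (λ v → 𝟙 (v ∈? C)) ≡ + ∣ C ∣
  sumV-∈ []            = refl
  sumV-∈ (inside ∷ C)  = cong (_+_ 1ℤ) (sumV-∈ C)
  sumV-∈ (outside ∷ C) = trans (ℤ.+-identityˡ _) (sumV-∈ C)

sumT-telescope : ∀ T (f g : ℕ → ℤ) → (∀ s → s < T → f (suc s) ≡ f s + g (suc s)) →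
                 f T ≡ f 0 + sumT T g
sumT-telescope zero    f g step = ≡.sym (ℤ.+-identityʳ (f 0))
sumT-telescope (suc T) f g step = begin
  f (suc T)                    ≡⟨ step T ≤-refl ⟩
  f T + g (suc T)              ≡⟨ cong (_+ g (suc T)) (sumT-telescope T f g (λ s → step s ∘ m≤n⇒m≤1+n)) ⟩
  f 0 + sumT T g + g (suc T)   ≡⟨ ℤ.+-assoc (f 0) (sumT T g) (g (suc T)) ⟩
  f 0 + sumT (suc T) g         ∎
  where open ≡-Reasoning

sumT-𝟙≤ : ∀ T k → sumT T (λ t → 𝟙 (t ≤? k)) ≡ + (T ⊓ k)
sumT-𝟙≤ T k = begin
  sumT T (λ t → 𝟙 (t ≤? k))             ≡⟨ ℤ.+-identityˡ _ ⟨
  + (0 ⊓ k) + sumT T (λ t → 𝟙 (t ≤? k))  ≡⟨ sumT-telescope T (λ t → + (t ⊓ k)) _ (λ s _ → step s) ⟨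
  + (T ⊓ k)                             ∎
  where
  open ≡-Reasoning
  step : ∀ s → + (suc s ⊓ k) ≡ + (s ⊓ k) + 𝟙 (suc s ≤? k)
  step s with ℕ.<-≤-connex s k
  ... | inj₁ s<k rewrite 𝟙-true (suc s ≤? k) s<k | m≤n⇒m⊓n≡m s<k | m≤n⇒m⊓n≡m (<⇒≤ s<k) =
          trans (cong +_ (ℕ.+-comm 1 s)) (ℤ.pos-+ s 1)
  ... | inj₂ k≤s rewrite 𝟙-false (suc s ≤? k) (<⇒≱ (s≤s k≤s)) | m≥n⇒m⊓n≡n (m≤n⇒m≤1+n k≤s) | m≥n⇒m⊓n≡n k≤s =
          ≡.sym (ℤ.+-identityʳ _)

max : (Fin n → ℕ) → ℕ
max {zero}  f = 0
max {suc n} f = f zero ⊔ max (f ∘ suc)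

≤-max : (f : Fin n → ℕ) → ∀ v → f v ≤ max f
≤-max f zero    = m≤m⊔n (f zero) _
≤-max f (suc v) = ≤-trans (≤-max (f ∘ suc) v) (m≤n⊔m (f zero) _)

max-lub : ∀ {m} (f : Fin n → ℕ) → (∀ v → f v ≤ m) → max f ≤ m
max-lub {zero}  f f≤m = z≤n
max-lub {suc n} f f≤m = ⊔-lub (f≤m zero) (max-lub (f ∘ suc) (f≤m ∘ suc))

module _ (G : Graph n) {u v : Fin n} where

  sumNbrExcept-mono : {f g : Fin n → ℤ} → (∀ w → f w ℤ.≤ g w) →
                      sumNbrExcept G u v f ℤ.≤ sumNbrExcept G u v g
  sumNbrExcept-mono f≤g = sumV-mono (λ w → if-mono _ (f≤g w))

  sumNbrExcept-mono-< : {f g : Fin n → ℤ} → (∀ w → f w ℤ.≤ g w) →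
                        ∀ w → adj G u w ≡ true → w ≢ v → f w ℤ.< g w →
                        sumNbrExcept G u v f ℤ.< sumNbrExcept G u v g
  sumNbrExcept-mono-< {f} {g} f≤g w uw w≢v fw<gw = sumV-mono-< (λ w → if-mono _ (f≤g w)) w at-w
    where
    at-w : (if adj G u w ∧ not (does (w ≟ v)) then f w else 0ℤ) ℤ.<
           (if adj G u w ∧ not (does (w ≟ v)) then g w else 0ℤ)
    at-w rewrite uw | dec-false (w ≟ v) w≢v = fw<gw

  deg≡sumNbrExcept+1 : adj G u v ≡ true → deg G u ≡ sumNbrExcept G u v (λ _ → 1ℤ) + 1ℤ
  deg≡sumNbrExcept+1 uv = begin
    deg G u                               ≡⟨ sumV-cong split ⟩
    sumV (λ w → others w + 𝟙 (w ≟ v))     ≡⟨ sumV-+ others (λ w → 𝟙 (w ≟ v)) ⟩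
    sumV others + sumV (λ w → 𝟙 (w ≟ v))  ≡⟨ cong (_+_ (sumV others)) single ⟩
    sumV others + 1ℤ                      ∎
    where
    open ≡-Reasoning
    others : Fin n → ℤ
    others w = if adj G u w ∧ not (does (w ≟ v)) then 1ℤ else 0ℤ
    split : ∀ w → (if adj G u w then 1ℤ else 0ℤ) ≡ others w + 𝟙 (w ≟ v)
    split w with w ≟ v
    ... | yes refl rewrite uv = ≡.sym (cong (_+_ 0ℤ) (𝟙-true _ refl))
    ... | no w≢v with adj G u w
    ...   | true  = ≡.sym (cong (_+_ 1ℤ) (𝟙-false _ w≢v))
    ...   | false = ≡.sym (cong (_+_ 0ℤ) (𝟙-false _ w≢v))
    single : sumV (λ w → 𝟙 (w ≟ v)) ≡ 1ℤ
    single = trans (sumV-delta _ v (λ w → 𝟙-false (w ≟ v))) (𝟙-true (v ≟ v) refl)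

module PropagationTime {G : Graph n} {T : ℕ} {C : Subset n} (game : ZGame G T C) where
  open ZGame game

  forced-at : ∀ {s v} → suc s ≡ time v →
              adj G (forcer v) v ≡ true × time (forcer v) ≤ s ×
              (∀ w → adj G (forcer v) w ≡ true → w ≢ v → time w ≤ s)
  forced-at {s} {v} s+1≡tv with valid v (subst (1 ≤_) s+1≡tv (s≤s z≤n))
  ... | uv , forcer< , others< = uv , before forcer< , λ w uw w≢v → before (others< w uw w≢v)
    where
    before : ∀ {m} → m < time v → m ≤ s
    before m<tv = ≤-pred (subst (_ <_) (≡.sym s+1≡tv) m<tv)

  Filled⇒time≤ : ∀ {t v} → Filled G C t v → time v ≤ t
  Filled⇒time≤ (base v∈C) = ≤-reflexive (proj₂ (initial _) v∈C)
  Filled⇒time≤ (keep filled) = m≤n⇒m≤1+n (Filled⇒time≤ filled)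
  Filled⇒time≤ {suc t} {v} (force u u-filled uv others-filled) with time v ≤? t
  ... | yes tv≤t = m≤n⇒m≤1+n tv≤t
  ... | no tv≰t = ≤-reflexive (maximal (suc t) u v (≰⇒> tv≰t) (s≤s (Filled⇒time≤ u-filled)) uv
                                (λ w uw w≢v → s≤s (Filled⇒time≤ (others-filled w uw w≢v))))

  time≤⇒Filled : ∀ t v → time v ≤ t → Filled G C t v
  time≤⇒Filled zero v tv≤0 = base (proj₁ (initial v) (n≤0⇒n≡0 tv≤0))
  time≤⇒Filled (suc t) v tv≤t+1 with time v ≤? t
  ... | yes tv≤t = keep (time≤⇒Filled t v tv≤t)
  ... | no tv≰t with forced-at (≤-antisym (≰⇒> tv≰t) tv≤t+1)
  ...   | uv , forcer≤t , others≤t =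
          force (forcer v) (time≤⇒Filled t (forcer v) forcer≤t) uv
                (λ w uw w≢v → time≤⇒Filled t w (others≤t w uw w≢v))

  pt : ℕ
  pt = max time

  time≤pt : ∀ v → time v ≤ pt
  time≤pt = ≤-max time

  isPT : IsPT G C pt
  isPT = (λ v → time≤⇒Filled pt v (time≤pt v))
       , λ j j<pt all-filled → <⇒≱ j<pt (max-lub time (λ v → Filled⇒time≤ (all-filled v)))

  pt≤T : pt ≤ T
  pt≤T = max-lub time bounded

  -- Strong induction on time v: a vertex forced after an empty step s+1 could
  -- already have been forced at step s+1.
  gap⇒time≤ : ∀ {s} → (∀ v → time v ≢ suc s) → ∀ v → time v ≤ s
  gap⇒time≤ {s} gap v = go v (<-wellFounded (time v))
    where
    go : ∀ v → Acc _<_ (time v) → time v ≤ s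
    go v (acc earlier) with time v ≤? s
    ... | yes tv≤s = tv≤s
    ... | no tv≰s with valid v (≤-trans (s≤s z≤n) (≰⇒> tv≰s))
    ...   | uv , forcer< , others< =
            contradiction (maximal (suc s) (forcer v) v (≰⇒> tv≰s) (s≤s (below forcer<)) uv
                                   (λ w uw w≢v → s≤s (below (others< w uw w≢v))))
                          (gap v)
      where
      below : ∀ {w} → time w < time v → time w ≤ s
      below {w} tw<tv = go w (earlier tw<tv)

  step-nonempty : ∀ {s} → s < pt → ∃ λ v → time v ≡ suc s
  step-nonempty {s} s<pt with any? (λ v → time v ℕ.≟ suc s)
  ... | yes found = found
  ... | no none = contradiction (max-lub time (gap⇒time≤ (λ v tv≡s+1 → none (v , tv≡s+1)))) (<⇒≱ s<pt)

module TimeStepSolution {G : Graph n} {T : ℕ} {C : Subset n} (game : ZGame G T C) where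
  open ZGame game
  open PropagationTime game

  x : ℕ → Fin n → ℤ
  x t v = 𝟙 (time v ≤? t)

  y : ℕ → Fin n → Fin n → ℤ
  y t u v = 𝟙 ((t ℕ.≟ time v) ×-dec (u ≟ forcer v))

  z : ℕ → ℤ
  z t = 𝟙 (t ≤? pt)

  new : ℕ → Fin n → ℤ
  new t v = 𝟙 (t ℕ.≟ time v)

  x-step : ∀ s v → x (suc s) v ≡ x s v + new (suc s) v
  x-step s v with ℕ.≤-<-connex (time v) s
  ... | inj₁ tv≤s = begin
    x (suc s) v            ≡⟨ 𝟙-true _ (m≤n⇒m≤1+n tv≤s) ⟩
    1ℤ + 0ℤ                ≡⟨ cong₂ _+_ (𝟙-true _ tv≤s) (𝟙-false _ λ s+1≡tv → <⇒≱ (≤-reflexive s+1≡tv) tv≤s) ⟨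
    x s v + new (suc s) v  ∎
    where open ≡-Reasoning
  ... | inj₂ s<tv = begin
    x (suc s) v            ≡⟨ 𝟙-cong (≤-antisym s<tv) (≤-reflexive ∘ ≡.sym) _ _ ⟩
    new (suc s) v          ≡⟨ ℤ.+-identityˡ _ ⟨
    0ℤ + new (suc s) v     ≡⟨ cong (_+ new (suc s) v) (𝟙-false _ (<⇒≱ s<tv)) ⟨
    x s v + new (suc s) v  ∎
    where open ≡-Reasoning

  sumIn-y : ∀ s v → sumIn G (y (suc s)) v ≡ new (suc s) v
  sumIn-y s v = trans (sumV-delta _ (forcer v) others) (at-forcer (suc s ℕ.≟ time v))
    where
    others : ∀ u → u ≢ forcer v → (if adj G u v then y (suc s) u v else 0ℤ) ≡ 0ℤ
    others u u≢forcer = if-zero (adj G u v) (𝟙-false _ (u≢forcer ∘ proj₂))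
    at-forcer : Dec (suc s ≡ time v) →
                (if adj G (forcer v) v then y (suc s) (forcer v) v else 0ℤ) ≡ new (suc s) v
    at-forcer (yes s+1≡tv) rewrite proj₁ (forced-at s+1≡tv) =
      trans (𝟙-true _ (s+1≡tv , refl)) (≡.sym (𝟙-true _ s+1≡tv))
    at-forcer (no s+1≢tv) = trans (if-zero _ (𝟙-false _ (s+1≢tv ∘ proj₁))) (≡.sym (𝟙-false _ s+1≢tv))

  c4 : ∀ s → s < T → ∀ v → x (suc s) v ≡ x s v + sumIn G (y (suc s)) v
  c4 s _ v = trans (x-step s v) (cong (_+_ (x s v)) (≡.sym (sumIn-y s v)))

  c1 : ∀ v → x 0 v + sumT T (λ t → sumIn G (y t) v) ≡ 1ℤ
  c1 v = trans (≡.sym (sumT-telescope T (λ t → x t v) _ (λ s s<T → c4 s s<T v))) (𝟙-true _ (bounded v))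

  y≤x : ∀ {s u v w} → (suc s ≡ time v → u ≡ forcer v → time w ≤ s) → y (suc s) u v ℤ.≤ x s w
  y≤x h = 𝟙-mono (λ (s+1≡tv , u≡forcer) → h s+1≡tv u≡forcer) _ _

  c2 : ∀ s → s < T → ∀ u v → adj G u v ≡ true → y (suc s) u v ℤ.≤ x s u
  c2 s _ u v _ = y≤x λ { s+1≡tv refl → proj₁ (proj₂ (forced-at s+1≡tv)) }

  c3 : ∀ s → s < T → ∀ u v w → adj G u v ≡ true → adj G u w ≡ true → w ≢ v → y (suc s) u v ℤ.≤ x s w
  c3 s _ u v w _ uw w≢v = y≤x λ { s+1≡tv refl → proj₂ (proj₂ (forced-at s+1≡tv)) w uw w≢v }

  sumNbrExcept-x≤1 : ∀ {s u v} → sumNbrExcept G u v (x s) ℤ.≤ sumNbrExcept G u v (λ _ → 1ℤ)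
  sumNbrExcept-x≤1 = sumNbrExcept-mono G (λ w → 𝟙≤1 _)

  i≤new+i : ∀ {s v i} → i ℤ.≤ new s v + i
  i≤new+i {i = i} = ℤ.≤-trans (ℤ.≤-reflexive (≡.sym (ℤ.+-identityˡ i))) (ℤ.+-monoˡ-≤ i (0≤𝟙 _))

  -- Only x s u = 1, x s v = 0 is delicate: either another neighbour of u is
  -- unfilled, which leaves slack 1 in the neighbour sum, or maximality of the
  -- game forces v at step s+1.
  forcing-bound : ∀ s {u v} → adj G u v ≡ true →
                  x s u - x s v + sumNbrExcept G u v (x s) ℤ.≤ new (suc s) v + sumNbrExcept G u v (λ _ → 1ℤ)
  forcing-bound s {u} {v} uv with ℕ.≤-<-connex (time v) s | ℕ.≤-<-connex (time u) s
  ... | inj₁ tv≤s | _ rewrite 𝟙-true (time v ≤? s) tv≤s =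
        ℤ.+-mono-≤ (ℤ.≤-trans (ℤ.i≤j⇒i-j≤0 (𝟙≤1 _)) (0≤𝟙 _)) sumNbrExcept-x≤1
  ... | inj₂ s<tv | inj₂ s<tu rewrite 𝟙-false (time v ≤? s) (<⇒≱ s<tv) | 𝟙-false (time u ≤? s) (<⇒≱ s<tu) =
        ℤ.+-mono-≤ (0≤𝟙 _) sumNbrExcept-x≤1
  ... | inj₂ s<tv | inj₁ tu≤s rewrite 𝟙-false (time v ≤? s) (<⇒≱ s<tv) | 𝟙-true (time u ≤? s) tu≤s
    with any? (λ w → (adj G u w Bool.≟ true) ×-dec ¬? (w ≟ v) ×-dec ¬? (time w ≤? s))
  ...   | yes (w , uw , w≢v , tw≰s) =
          ℤ.≤-trans (ℤ.i<j⇒suc[i]≤j (sumNbrExcept-mono-< G (λ w → 𝟙≤1 _) w uw w≢v unfilled)) i≤new+i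
    where
    unfilled : x s w ℤ.< 1ℤ
    unfilled = ℤ.≤-<-trans (ℤ.≤-reflexive (𝟙-false _ tw≰s)) (ℤ.+<+ (s≤s z≤n))
  ...   | no none = ℤ.+-mono-≤ (ℤ.≤-reflexive (≡.sym (𝟙-true _ (≡.sym v-forced)))) sumNbrExcept-x≤1
    where
    others-filled : ∀ w → adj G u w ≡ true → w ≢ v → time w ≤ s
    others-filled w uw w≢v = decidable-stable (time w ≤? s) λ tw≰s → none (w , uw , w≢v , tw≰s)
    v-forced : time v ≡ suc s
    v-forced = maximal (suc s) u v s<tv (s≤s tu≤s) uv (λ w uw w≢v → s≤s (others-filled w uw w≢v))


  c5 : ∀ s → s < T → ∀ u v → adj G u v ≡ true →
       x s u - x s v + sumNbrExcept G u v (x s) ℤ.≤ sumIn G (y (suc s)) v + deg G u - 1ℤ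
  c5 s _ u v uv = ℤ.≤-trans (forcing-bound s uv) (ℤ.≤-reflexive (≡.sym rhs))
    where
    i+[j+1]-1≡i+j : ∀ i j → i + (j + 1ℤ) - 1ℤ ≡ i + j
    i+[j+1]-1≡i+j = solve-∀
    rhs : sumIn G (y (suc s)) v + deg G u - 1ℤ ≡ new (suc s) v + sumNbrExcept G u v (λ _ → 1ℤ)
    rhs rewrite sumIn-y s v | deg≡sumNbrExcept+1 G uv =
      i+[j+1]-1≡i+j (new (suc s) v) (sumNbrExcept G u v (λ _ → 1ℤ))

  sumV-increment : ∀ s → sumV (λ v → x (suc s) v - x s v) ≡ sumV (new (suc s))
  sumV-increment s = sumV-cong λ v → trans (cong (_- x s v) (x-step s v)) (i+j-i≡j (x s v) _)
    where
    i+j-i≡j : ∀ i j → i + j - i ≡ j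
    i+j-i≡j = solve-∀

  c6 : ∀ s → s < T → sumV (λ v → x (suc s) v - x s v) ℤ.≤ + n * z (suc s)
  c6 s _ = begin
    sumV (λ v → x (suc s) v - x s v)  ≡⟨ sumV-increment s ⟩
    sumV (new (suc s))                ≤⟨ sumV-mono (λ v → 𝟙-mono (new⇒≤pt v) _ _) ⟩
    sumV {n} (λ _ → z (suc s))        ≡⟨ sumV-const n _ ⟩
    + n * z (suc s)                   ∎
    where
    open ℤ.≤-Reasoning
    new⇒≤pt : ∀ v → suc s ≡ time v → suc s ≤ pt
    new⇒≤pt v s+1≡tv = subst (_≤ pt) (≡.sym s+1≡tv) (time≤pt v)

  z≤sumV-new : ∀ s → z (suc s) ℤ.≤ sumV (new (suc s))
  z≤sumV-new s with ℕ.<-≤-connex s pt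
  ... | inj₂ pt≤s = begin
    z (suc s)            ≡⟨ 𝟙-false _ (<⇒≱ (s≤s pt≤s)) ⟩
    0ℤ                   ≡⟨ sumV-zero {n} (λ _ → refl) ⟨
    sumV {n} (λ _ → 0ℤ)  ≤⟨ sumV-mono {n} (λ v → 0≤𝟙 _) ⟩
    sumV (new (suc s))   ∎
    where open ℤ.≤-Reasoning
  ... | inj₁ s<pt with step-nonempty s<pt
  ...   | v , tv≡s+1 = begin
    z (suc s)                    ≡⟨ 𝟙-true _ s<pt ⟩
    ℤ.suc 0ℤ                     ≡⟨ cong ℤ.suc (sumV-zero {n} (λ _ → refl)) ⟨
    ℤ.suc (sumV {n} (λ _ → 0ℤ))  ≤⟨ ℤ.i<j⇒suc[i]≤j (sumV-mono-< {n} (λ w → 0≤𝟙 _) v v-new) ⟩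
    sumV (new (suc s))           ∎
    where
    open ℤ.≤-Reasoning
    v-new : 0ℤ ℤ.< new (suc s) v
    v-new = ℤ.<-≤-trans (ℤ.+<+ (s≤s z≤n)) (ℤ.≤-reflexive (≡.sym (𝟙-true _ (≡.sym tv≡s+1))))

  c7 : ∀ s → s < T → z (suc s) - sumV (λ v → x (suc s) v - x s v) ℤ.≤ 0ℤ
  c7 s _ = ℤ.i≤j⇒i-j≤0 (ℤ.≤-trans (z≤sumV-new s) (ℤ.≤-reflexive (≡.sym (sumV-increment s))))

  feasible : Feasible G T x y z
  feasible = record
    { x-bin = λ _ _ _ → 𝟙-binary _
    ; y-bin = λ _ _ _ _ _ _ → 𝟙-binary _
    ; z-bin = λ _ _ _ → 𝟙-binary _
    ; c1 = c1 ; c2 = c2 ; c3 = c3 ; c4 = c4 ; c5 = c5 ; c6 = c6 ; c7 = c7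
    }

  ∣C∣≡sumV-x₀ : + ∣ C ∣ ≡ sumV (x 0)
  ∣C∣≡sumV-x₀ = ≡.sym (trans (sumV-cong λ v → 𝟙-cong (initial-time v) (initial-time⁻¹ v) _ _) (sumV-∈ C))
    where
    initial-time : ∀ v → time v ≤ 0 → v ∈ C
    initial-time v tv≤0 = proj₁ (initial v) (n≤0⇒n≡0 tv≤0)
    initial-time⁻¹ : ∀ v → v ∈ C → time v ≤ 0
    initial-time⁻¹ v v∈C = ≤-reflexive (proj₂ (initial v) v∈C)

  sumT-z≡pt : sumT T z ≡ + pt
  sumT-z≡pt = trans (sumT-𝟙≤ T pt) (cong +_ (m≥n⇒m⊓n≡n pt≤T))

theorem4p3 : ∀ {n} (G : Graph n) (T : ℕ) → 1 ≤ T →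
    (C : Subset n) → ZGame G T C →
    Σ (ℕ → Fin n → ℤ) λ x → Σ (ℕ → Fin n → Fin n → ℤ) λ y → Σ (ℕ → ℤ) λ z →
      Feasible G T x y z ×
      (+ ∣ C ∣ ≡ sumV (x 0)) ×
      (∃ λ k → IsPT G C k × (sumT T z ≡ + k) × (k ≤ T))
theorem4p3 G T _ C game = x , y , z , feasible , ∣C∣≡sumV-x₀ , pt , isPT , sumT-z≡pt , pt≤T
  where
  open PropagationTime game
  open TimeStepSolution game
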